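{- Let $k,n,m,\lambda$ be non-negative integers with $m \ge k-n+1$ and $\lambda \le \min\{\lfloor m/2 \rfloor,\, n-k+m\}$. Then $$Z(k,n,m,\lambda) = \binom{n}{\lambda}\binom{k}{m}\frac{(n-\lambda)!}{(n-\lambda+m-k)!}\, s(m,\lambda).$$
   Context: Fix $n$ colors. A sequence of $k$ balls colored in at most $n$ colors is a function $c:\{1,\dots,k\}\to\{1,\dots,n\}$ (balls of the same color are indistinguishable, positions are distinguishable). A ball (position) $i$ is said to match another ball if there is $j\ne i$ with $c(j)=c(i)$; a color is repeated if it is the color of at least two balls. $Z(k,n,m,\lambda)$ denotes the number of such sequences in which exactly $m$ balls match some other ball and exactly $\lambda$ colors are repeated. $s(m,\lambda)$ denotes the number of doubly-surjective functions from an $m$-element set to a $\lambda$-element set, i.e. functions for which every element of the codomain has at least two preimages (with $s(0,0)=1$). The convention $\binom{k}{m}=0$ for $m>k$ is used. -}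

module Defs where

open import Data.Nat using (ℕ; zero; suc; _+_; _≤_; _≤?_)
open import Data.Fin using (Fin; zero; suc)
open import Data.Fin.Properties using (_≟_)
open import Data.List using (List; []; _∷_; map; concatMap; length; filter; allFin)
open import Data.Bool using (Bool; true; false; if_then_else_)
open import Relation.Nullary using (Dec; yes; no; ¬_)
open import Relation.Nullary.Decidable using (⌊_⌋)
open import Relation.Binary.PropositionalEquality using (_≡_)

allFuns : (k n : ℕ) → List (Fin k → Fin n)
allFuns zero    n = (λ ()) ∷ []
allFuns (suc k) n =
  concatMap (λ (a : Fin n) → map (λ (f : Fin k → Fin n) → extend a f) (allFuns k n)) (allFin n)
  where
  extend : Fin n → (Fin k → Fin n) → Fin (suc k) → Fin n
  extend a f zero    = a
  extend a f (suc i) = f i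

countFin : (k : ℕ) → (Fin k → Bool) → ℕ
countFin k p = length (filter (λ i → p i Data.Bool.≟ true) (allFin k))
  where import Data.Bool

countFuns : (k n : ℕ) → ((Fin k → Fin n) → Bool) → ℕ
countFuns k n P = length (filter (λ f → P f Data.Bool.≟ true) (allFuns k n))
  where import Data.Bool

preimageCount : {k n : ℕ} → (Fin k → Fin n) → Fin n → ℕ
preimageCount {k} c x = countFin k (λ j → ⌊ c j ≟ x ⌋)

-- ball i matches another ball: some j ≠ i with c j = c i, i.e. colour of i used ≥ 2 times
matches : {k n : ℕ} → (Fin k → Fin n) → Fin k → Bool
matches c i = ⌊ 2 ≤? preimageCount c (c i) ⌋

repeated : {k n : ℕ} → (Fin k → Fin n) → Fin n → Bool
repeated c x = ⌊ 2 ≤? preimageCount c x ⌋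

matchingBalls : {k n : ℕ} → (Fin k → Fin n) → ℕ
matchingBalls {k} c = countFin k (matches c)

repeatedColours : {k n : ℕ} → (Fin k → Fin n) → ℕ
repeatedColours {n = n} c = countFin n (repeated c)

Z : ℕ → ℕ → ℕ → ℕ → ℕ
Z k n m l = countFuns k n (λ c → ⌊ matchingBalls c Data.Nat.≟ m ⌋ ∧ ⌊ repeatedColours c Data.Nat.≟ l ⌋)
  where import Data.Nat
        open Data.Bool using (_∧_)

allFinB : (n : ℕ) → (Fin n → Bool) → Bool
allFinB zero    p = true
allFinB (suc n) p = if p zero then allFinB n (λ i → p (suc i)) else false

s : ℕ → ℕ → ℕ
s m l = countFuns m l (λ f → allFinB l (λ x → ⌊ 2 ≤? preimageCount f x ⌋))

module Submission where

-- Write M(c) and R(c) for the numbers of matching balls and of repeated colours of a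
-- colouring c : Fin k → Fin n.  Prepending a new ball of colour a to c changes these
-- statistics according to the number q of balls of colour a already present:
-- q = 0 leaves them unchanged, q = 1 turns a single ball into a pair (M += 2, R += 1),
-- and q ≥ 2 adds a ball to a repeated colour (M += 1).  Counting the colours of each
-- kind in terms of M and R gives the recurrence (Z-rec)
--   Z(k+1,n,m,l) = (n - l - (k-m)) Z(k,n,m,l) + (k-m+2) Z(k,n,m-2,l-1) + l Z(k,n,m-1,l).
-- The same recurrence at k = m, n = l yields s(m+1,l) = l s(m,l) + l m s(m-1,l-1).
-- We then show by strong induction on k that, for all n m l,
--   Z(k,n,m,l) = C(n,l) C(k,m) (n-l)^(k-m) s(m,l)       (falling factorial (n-l)^(k-m)),
-- because the right-hand side satisfies the same recurrence (Pascal's rule and the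
-- absorption identity C(n,k)(n-k) = C(n,k+1)(k+1)), the recurrence for s at m needing
-- the closed form at the smaller length m-1.  The theorem follows by clearing the
-- denominator: (n-l)^(k-m) (n-l-(k-m))! = (n-l)!.

open import Defs
open import Algebra.Properties.CommutativeSemigroup using (interchange)
open import Data.Bool using (Bool; true; false; _∧_; T)
open import Data.Unit using (tt)
import Data.Bool.Properties as Bool
open import Data.Fin using (Fin; zero; suc)
import Data.Fin.Properties as Fin
open import Data.List using (List; []; _∷_; _++_; map; concatMap; length; filter; tabulate; allFin)
open import Data.Nat using (ℕ; zero; suc; pred; _+_; _*_; _∸_; _≤_; _<_; _!; z≤n; s≤s; _≡ᵇ_; _≤ᵇ_; z<s)
open import Data.Nat.Combinatorics
  using (_C_; nCn≡1; nC1≡n; k>n⇒nCk≡0; nCk+nC[k+1]≡[n+1]C[k+1]; [n-k]*[n-k-1]!≡[n-k]!)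
open import Data.Nat.Combinatorics.Base using (_P′_)
open import Data.Nat.Induction using (<-rec)
open import Data.Nat.Properties
open import Data.Nat.Solver using (module +-*-Solver)
open import Data.Sum using (inj₁; inj₂)
open import Function using (Equivalence)
open import Relation.Nullary using (does; yes; no; contradiction)
open import Relation.Nullary.Decidable using (isYes≗does)
open import Relation.Binary.PropositionalEquality

open import Algebra.Properties.Semiring.Sum +-*-semiring
  using (sum; sum-syntax; sum-cong-≗; sum-replicate-zero; ∑-distrib-+; ∑-comm; *-distribˡ-sum; *-distribʳ-sum)

open +-*-Solver
open ≡-Reasoning

-- Finite sums and counting

𝟙 : Bool → ℕ
𝟙 true  = 1
𝟙 false = 0

∑ₗ : {A : Set} → List A → (A → ℕ) → ℕ
∑ₗ []       g = 0
∑ₗ (x ∷ xs) g = g x + ∑ₗ xs g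

∑-one : (n : ℕ) → ∑[ i < n ] 1 ≡ n
∑-one zero    = refl
∑-one (suc n) = cong suc (∑-one n)

module _ {A : Set} where

  length-filter : (P : A → Bool) (xs : List A) →
    length (filter (λ x → P x Bool.≟ true) xs) ≡ ∑ₗ xs (λ x → 𝟙 (P x))
  length-filter P []       = refl
  length-filter P (x ∷ xs) with P x
  ... | true  = cong suc (length-filter P xs)
  ... | false = length-filter P xs

  ∑ₗ-cong : (xs : List A) {g h : A → ℕ} → (∀ x → g x ≡ h x) → ∑ₗ xs g ≡ ∑ₗ xs h
  ∑ₗ-cong []       g≗h = refl
  ∑ₗ-cong (x ∷ xs) g≗h = cong₂ _+_ (g≗h x) (∑ₗ-cong xs g≗h)

  ∑ₗ-zero : (xs : List A) → ∑ₗ xs (λ _ → 0) ≡ 0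
  ∑ₗ-zero []       = refl
  ∑ₗ-zero (x ∷ xs) = ∑ₗ-zero xs

  ∑ₗ-+ : (xs : List A) (g h : A → ℕ) → ∑ₗ xs (λ x → g x + h x) ≡ ∑ₗ xs g + ∑ₗ xs h
  ∑ₗ-+ []       g h = refl
  ∑ₗ-+ (x ∷ xs) g h = trans (cong (g x + h x +_) (∑ₗ-+ xs g h))
                            (interchange +-commutativeSemigroup (g x) (h x) _ _)

  ∑ₗ-*ˡ : (xs : List A) (c : ℕ) (g : A → ℕ) → ∑ₗ xs (λ x → c * g x) ≡ c * ∑ₗ xs g
  ∑ₗ-*ˡ []       c g = sym (*-zeroʳ c)
  ∑ₗ-*ˡ (x ∷ xs) c g = trans (cong (c * g x +_) (∑ₗ-*ˡ xs c g)) (sym (*-distribˡ-+ c (g x) _))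

  ∑ₗ-++ : (xs ys : List A) (g : A → ℕ) → ∑ₗ (xs ++ ys) g ≡ ∑ₗ xs g + ∑ₗ ys g
  ∑ₗ-++ []       ys g = refl
  ∑ₗ-++ (x ∷ xs) ys g = trans (cong (g x +_) (∑ₗ-++ xs ys g)) (sym (+-assoc (g x) _ _))

  ∑-∑ₗ-comm : (n : ℕ) (xs : List A) (g : Fin n → A → ℕ) →
    ∑[ a < n ] ∑ₗ xs (g a) ≡ ∑ₗ xs (λ x → ∑[ a < n ] g a x)
  ∑-∑ₗ-comm n []       g = sum-replicate-zero n
  ∑-∑ₗ-comm n (x ∷ xs) g = trans (∑-distrib-+ (λ a → g a x) (λ a → ∑ₗ xs (g a)))
                                 (cong (∑[ a < n ] g a x +_) (∑-∑ₗ-comm n xs g))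

∑ₗ-map : {A B : Set} (f : A → B) (xs : List A) (g : B → ℕ) → ∑ₗ (map f xs) g ≡ ∑ₗ xs (λ x → g (f x))
∑ₗ-map f []       g = refl
∑ₗ-map f (x ∷ xs) g = cong (g (f x) +_) (∑ₗ-map f xs g)

∑ₗ-concatMap : {A B : Set} (f : A → List B) (xs : List A) (g : B → ℕ) →
  ∑ₗ (concatMap f xs) g ≡ ∑ₗ xs (λ x → ∑ₗ (f x) g)
∑ₗ-concatMap f []       g = refl
∑ₗ-concatMap f (x ∷ xs) g = trans (∑ₗ-++ (f x) (concatMap f xs) g) (cong (∑ₗ (f x) g +_) (∑ₗ-concatMap f xs g))

∑ₗ-tabulate : {B : Set} (n : ℕ) (t : Fin n → B) (g : B → ℕ) → ∑ₗ (tabulate t) g ≡ ∑[ i < n ] g (t i)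
∑ₗ-tabulate zero    t g = refl
∑ₗ-tabulate (suc n) t g = cong (g (t zero) +_) (∑ₗ-tabulate n (λ i → t (suc i)) g)

countFin-as-sum : (k : ℕ) (p : Fin k → Bool) → countFin k p ≡ ∑[ i < k ] 𝟙 (p i)
countFin-as-sum k p = trans (length-filter p (allFin k)) (∑ₗ-tabulate k (λ i → i) (λ i → 𝟙 (p i)))

countFuns-as-sum : (k n : ℕ) (P : (Fin k → Fin n) → Bool) → countFuns k n P ≡ ∑ₗ (allFuns k n) (λ f → 𝟙 (P f))
countFuns-as-sum k n P = length-filter P (allFuns k n)

∑-select : (n : ℕ) (g : Fin n → ℕ) (y : Fin n) → ∑[ x < n ] (g x * 𝟙 (does (y Fin.≟ x))) ≡ g y
∑-select (suc n) g zero = begin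
  g zero * 1 + ∑[ x < n ] (g (suc x) * 0) ≡⟨ cong₂ _+_ (*-identityʳ (g zero))
                                             (trans (sum-cong-≗ (λ x → *-zeroʳ (g (suc x)))) (sum-replicate-zero n)) ⟩
  g zero + 0                            ≡⟨ +-identityʳ (g zero) ⟩
  g zero                                ∎
∑-select (suc n) g (suc y) = cong₂ _+_ (*-zeroʳ (g zero)) (∑-select n (λ x → g (suc x)) y)

-- Colour statistics of a colouring c : Fin k → Fin n

preimageCount-as-sum : {k n : ℕ} (c : Fin k → Fin n) (x : Fin n) →
  preimageCount c x ≡ ∑[ j < k ] 𝟙 (does (c j Fin.≟ x))
preimageCount-as-sum {k} c x =
  trans (countFin-as-sum k _) (sum-cong-≗ (λ j → cong 𝟙 (isYes≗does (c j Fin.≟ x))))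

∑-fibres : {k n : ℕ} (c : Fin k → Fin n) (g : Fin n → ℕ) →
  ∑[ i < k ] g (c i) ≡ ∑[ x < n ] (g x * preimageCount c x)
∑-fibres {k} {n} c g = sym (begin
  ∑[ x < n ] (g x * preimageCount c x)
    ≡⟨ sum-cong-≗ (λ x → cong (g x *_) (preimageCount-as-sum c x)) ⟩
  ∑[ x < n ] (g x * ∑[ j < k ] δ j x)        ≡⟨ sum-cong-≗ (λ x → *-distribˡ-sum (g x) (λ j → δ j x)) ⟩
  ∑[ x < n ] ∑[ j < k ] (g x * δ j x)        ≡⟨ ∑-comm (λ x j → g x * δ j x) ⟩
  ∑[ j < k ] ∑[ x < n ] (g x * δ j x)        ≡⟨ sum-cong-≗ (λ j → ∑-select n g (c j)) ⟩
  ∑[ i < k ] g (c i)                        ∎)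
  where
  δ : Fin k → Fin n → ℕ
  δ j x = 𝟙 (does (c j Fin.≟ x))

-- A colour class of size q is vacant (q = 0), single (q = 1) or shared (q ≥ 2);
-- the balls of a shared class are exactly the matching ones.
vacant single shared sharedBalls : ℕ → ℕ
vacant zero    = 1
vacant (suc _) = 0
single (suc zero) = 1
single _          = 0
shared q = 𝟙 (2 ≤ᵇ q)
sharedBalls q = shared q * q

vacant+single+shared : ∀ q → vacant q + single q + shared q ≡ 1
vacant+single+shared zero          = refl
vacant+single+shared (suc zero)    = refl
vacant+single+shared (suc (suc q)) = refl

single+sharedBalls : ∀ q → single q + sharedBalls q ≡ q
single+sharedBalls zero          = refl
single+sharedBalls (suc zero)    = refl
single+sharedBalls (suc (suc q)) = +-identityʳ (suc (suc q))

module Statistics {k n : ℕ} (c : Fin k → Fin n) where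

  size : Fin n → ℕ
  size = preimageCount c

  matchingBalls-as-sum : matchingBalls c ≡ ∑[ x < n ] sharedBalls (size x)
  matchingBalls-as-sum = begin
    matchingBalls c                   ≡⟨ countFin-as-sum k (matches c) ⟩
    ∑[ i < k ] 𝟙 (matches c i)        ≡⟨ sum-cong-≗ (λ i → cong 𝟙 (isYes≗does (2 ≤? size (c i)))) ⟩
    ∑[ i < k ] shared (size (c i))    ≡⟨ ∑-fibres c (λ x → shared (size x)) ⟩
    ∑[ x < n ] sharedBalls (size x)   ∎

  repeatedColours-as-sum : repeatedColours c ≡ ∑[ x < n ] shared (size x)
  repeatedColours-as-sum =
    trans (countFin-as-sum n (repeated c)) (sum-cong-≗ (λ x → cong 𝟙 (isYes≗does (2 ≤? size x))))

  ∑-size : ∑[ x < n ] size x ≡ k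
  ∑-size = begin
    ∑[ x < n ] size x      ≡⟨ sum-cong-≗ (λ x → sym (*-identityˡ (size x))) ⟩
    ∑[ x < n ] (1 * size x)  ≡⟨ ∑-fibres c (λ _ → 1) ⟨
    ∑[ i < k ] 1           ≡⟨ ∑-one k ⟩
    k                      ∎

  #vacant #single : ℕ
  #vacant = ∑[ x < n ] vacant (size x)
  #single = ∑[ x < n ] single (size x)

  colour-kinds : #vacant + #single + repeatedColours c ≡ n
  colour-kinds = begin
    #vacant + #single + repeatedColours c
      ≡⟨ cong (#vacant + #single +_) repeatedColours-as-sum ⟩
    #vacant + #single + ∑[ x < n ] shared (size x)
      ≡⟨ cong (_+ ∑[ x < n ] shared (size x)) (∑-distrib-+ (λ x → vacant (size x)) (λ x → single (size x))) ⟨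
    ∑[ x < n ] (vacant (size x) + single (size x)) + ∑[ x < n ] shared (size x)
      ≡⟨ ∑-distrib-+ (λ x → vacant (size x) + single (size x)) (λ x → shared (size x)) ⟨
    ∑[ x < n ] (vacant (size x) + single (size x) + shared (size x))
      ≡⟨ sum-cong-≗ (λ x → vacant+single+shared (size x)) ⟩
    ∑[ x < n ] 1
      ≡⟨ ∑-one n ⟩
    n ∎

  #single+matching : #single + matchingBalls c ≡ k
  #single+matching = begin
    #single + matchingBalls c                       ≡⟨ cong (#single +_) matchingBalls-as-sum ⟩
    #single + ∑[ x < n ] sharedBalls (size x)       ≡⟨ ∑-distrib-+ (λ x → single (size x)) (λ x → sharedBalls (size x)) ⟨
    ∑[ x < n ] (single (size x) + sharedBalls (size x)) ≡⟨ sum-cong-≗ (λ x → single+sharedBalls (size x)) ⟩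
    ∑[ x < n ] size x                               ≡⟨ ∑-size ⟩
    k                                               ∎

  #single≡ : #single ≡ k ∸ matchingBalls c
  #single≡ = trans (sym (m+n∸n≡m #single (matchingBalls c))) (cong (_∸ matchingBalls c) #single+matching)

  #vacant≡ : #vacant ≡ n ∸ (repeatedColours c + (k ∸ matchingBalls c))
  #vacant≡ = begin
    #vacant                                  ≡⟨ m+n∸n≡m #vacant (#single + R) ⟨
    #vacant + (#single + R) ∸ (#single + R)  ≡⟨ cong₂ _∸_ (trans (sym (+-assoc #vacant #single R)) colour-kinds)
                                                          (trans (+-comm #single R) (cong (R +_) #single≡)) ⟩
    n ∸ (R + (k ∸ matchingBalls c))          ∎
    where R = repeatedColours c

  matchingBalls≤k : matchingBalls c ≤ k
  matchingBalls≤k = subst (matchingBalls c ≤_) #single+matching (m≤n+m (matchingBalls c) #single)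

  all-repeated⇒all-match : repeatedColours c ≡ n → matchingBalls c ≡ k
  all-repeated⇒all-match R≡n = trans (sym (cong (_+ matchingBalls c) #single≡0)) #single+matching
    where
    #vacant+#single≡0 : #vacant + #single ≡ 0
    #vacant+#single≡0 = +-cancelʳ-≡ n _ 0 (trans (cong (#vacant + #single +_) (sym R≡n)) colour-kinds)
    #single≡0 : #single ≡ 0
    #single≡0 = m+n≡0⇒n≡0 #vacant #vacant+#single≡0

-- Prepending a ball

record Prepending (k n : ℕ) : Set where
  field
    _◂_         : Fin n → (Fin k → Fin n) → Fin (suc k) → Fin n
    allFuns-suc : allFuns (suc k) n ≡ concatMap (λ a → map (a ◂_) (allFuns k n)) (allFin n)
    ◂-zero      : ∀ a f → (a ◂ f) zero ≡ a
    ◂-suc       : ∀ a f i → (a ◂ f) (suc i) ≡ f i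

prepending : ∀ k n → Prepending k n
prepending k n = record { _◂_ = _ ; allFuns-suc = refl ; ◂-zero = λ _ _ → refl ; ◂-suc = λ _ _ _ → refl }

∑-bump : (n : ℕ) (φ : ℕ → ℕ) (p : Fin n → ℕ) (a : Fin n) →
  ∑[ x < n ] φ (𝟙 (does (a Fin.≟ x)) + p x) + φ (p a) ≡ ∑[ x < n ] φ (p x) + φ (suc (p a))
∑-bump (suc n) φ p zero =
  solve 3 (λ A S B → A :+ S :+ B := B :+ S :+ A) refl (φ (suc (p zero))) (∑[ x < n ] φ (p (suc x))) (φ (p zero))
∑-bump (suc n) φ p (suc a) = begin
  φ (p zero) + ∑[ x < n ] φ (δ x + p (suc x)) + φ (p (suc a))   ≡⟨ +-assoc (φ (p zero)) _ _ ⟩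
  φ (p zero) + (∑[ x < n ] φ (δ x + p (suc x)) + φ (p (suc a))) ≡⟨ cong (φ (p zero) +_) (∑-bump n φ (λ x → p (suc x)) a) ⟩
  φ (p zero) + (∑[ x < n ] φ (p (suc x)) + φ (suc (p (suc a)))) ≡⟨ +-assoc (φ (p zero)) _ _ ⟨
  φ (p zero) + ∑[ x < n ] φ (p (suc x)) + φ (suc (p (suc a)))   ∎
  where
  δ : Fin n → ℕ
  δ x = 𝟙 (does (a Fin.≟ x))

matchesAfter repeatsAfter : ℕ → ℕ → ℕ
matchesAfter zero          M = M
matchesAfter (suc zero)    M = 2 + M
matchesAfter (suc (suc _)) M = 1 + M
repeatsAfter zero          R = R
repeatsAfter (suc zero)    R = 1 + R
repeatsAfter (suc (suc _)) R = R

matchesAfter-bump : ∀ q S′ S → S′ + sharedBalls q ≡ S + sharedBalls (suc q) → S′ ≡ matchesAfter q S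
matchesAfter-bump zero          S′ S e = trans (sym (+-identityʳ S′)) (trans e (+-identityʳ S))
matchesAfter-bump (suc zero)    S′ S e = trans (sym (+-identityʳ S′)) (trans e (+-comm S 2))
matchesAfter-bump (suc (suc q)) S′ S e =
  +-cancelʳ-≡ (suc (suc q) + 0) S′ (suc S) (trans e (+-suc S (suc (suc q) + 0)))

repeatsAfter-bump : ∀ q S′ S → S′ + shared q ≡ S + shared (suc q) → S′ ≡ repeatsAfter q S
repeatsAfter-bump zero          S′ S e = trans (sym (+-identityʳ S′)) (trans e (+-identityʳ S))
repeatsAfter-bump (suc zero)    S′ S e = trans (sym (+-identityʳ S′)) (trans e (+-comm S 1))
repeatsAfter-bump (suc (suc q)) S′ S e = +-cancelʳ-≡ 1 S′ S e

module Prepend (k n : ℕ) where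
  open Prepending (prepending k n) public

  size-◂ : ∀ a f x → preimageCount (a ◂ f) x ≡ 𝟙 (does (a Fin.≟ x)) + preimageCount f x
  size-◂ a f x = begin
    preimageCount (a ◂ f) x
      ≡⟨ preimageCount-as-sum (a ◂ f) x ⟩
    𝟙 (does ((a ◂ f) zero Fin.≟ x)) + ∑[ j < k ] 𝟙 (does ((a ◂ f) (suc j) Fin.≟ x))
      ≡⟨ cong₂ _+_ (cong (λ b → 𝟙 (does (b Fin.≟ x))) (◂-zero a f))
                   (sum-cong-≗ (λ j → cong (λ b → 𝟙 (does (b Fin.≟ x))) (◂-suc a f j))) ⟩
    𝟙 (does (a Fin.≟ x)) + ∑[ j < k ] 𝟙 (does (f j Fin.≟ x))
      ≡⟨ cong (𝟙 (does (a Fin.≟ x)) +_) (preimageCount-as-sum f x) ⟨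
    𝟙 (does (a Fin.≟ x)) + preimageCount f x ∎

  matchingBalls-◂ : ∀ a f → matchingBalls (a ◂ f) ≡ matchesAfter (preimageCount f a) (matchingBalls f)
  matchingBalls-◂ a f = begin
    matchingBalls (a ◂ f)
      ≡⟨ Statistics.matchingBalls-as-sum (a ◂ f) ⟩
    ∑[ x < n ] sharedBalls (preimageCount (a ◂ f) x)
      ≡⟨ sum-cong-≗ (λ x → cong sharedBalls (size-◂ a f x)) ⟩
    ∑[ x < n ] sharedBalls (𝟙 (does (a Fin.≟ x)) + preimageCount f x)
      ≡⟨ matchesAfter-bump (preimageCount f a) _ _ (∑-bump n sharedBalls (preimageCount f) a) ⟩
    matchesAfter (preimageCount f a) (∑[ x < n ] sharedBalls (preimageCount f x))
      ≡⟨ cong (matchesAfter (preimageCount f a)) (Statistics.matchingBalls-as-sum f) ⟨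
    matchesAfter (preimageCount f a) (matchingBalls f) ∎

  repeatedColours-◂ : ∀ a f → repeatedColours (a ◂ f) ≡ repeatsAfter (preimageCount f a) (repeatedColours f)
  repeatedColours-◂ a f = begin
    repeatedColours (a ◂ f)
      ≡⟨ Statistics.repeatedColours-as-sum (a ◂ f) ⟩
    ∑[ x < n ] shared (preimageCount (a ◂ f) x)
      ≡⟨ sum-cong-≗ (λ x → cong shared (size-◂ a f x)) ⟩
    ∑[ x < n ] shared (𝟙 (does (a Fin.≟ x)) + preimageCount f x)
      ≡⟨ repeatsAfter-bump (preimageCount f a) _ _ (∑-bump n shared (preimageCount f) a) ⟩
    repeatsAfter (preimageCount f a) (∑[ x < n ] shared (preimageCount f x))
      ≡⟨ cong (repeatsAfter (preimageCount f a)) (Statistics.repeatedColours-as-sum f) ⟨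
    repeatsAfter (preimageCount f a) (repeatedColours f) ∎

  ∑ₗ-allFuns-suc : (g : (Fin (suc k) → Fin n) → ℕ) →
    ∑ₗ (allFuns (suc k) n) g ≡ ∑ₗ (allFuns k n) (λ f → ∑[ a < n ] g (a ◂ f))
  ∑ₗ-allFuns-suc g = begin
    ∑ₗ (allFuns (suc k) n) g
      ≡⟨ cong (λ xs → ∑ₗ xs g) allFuns-suc ⟩
    ∑ₗ (concatMap (λ a → map (a ◂_) (allFuns k n)) (allFin n)) g
      ≡⟨ ∑ₗ-concatMap (λ a → map (a ◂_) (allFuns k n)) (allFin n) g ⟩
    ∑ₗ (allFin n) (λ a → ∑ₗ (map (a ◂_) (allFuns k n)) g)
      ≡⟨ ∑ₗ-cong (allFin n) (λ a → ∑ₗ-map (a ◂_) (allFuns k n) g) ⟩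
    ∑ₗ (allFin n) (λ a → ∑ₗ (allFuns k n) (λ f → g (a ◂ f)))
      ≡⟨ ∑ₗ-tabulate n (λ a → a) _ ⟩
    ∑[ a < n ] ∑ₗ (allFuns k n) (λ f → g (a ◂ f))
      ≡⟨ ∑-∑ₗ-comm n (allFuns k n) (λ a f → g (a ◂ f)) ⟩
    ∑ₗ (allFuns k n) (λ f → ∑[ a < n ] g (a ◂ f)) ∎

-- The recurrence for Z

hit : ℕ → ℕ → ℕ → ℕ → ℕ
hit x y m l = 𝟙 ((x ≡ᵇ m) ∧ (y ≡ᵇ l))

hit-miss : ∀ {x m} y l → x ≢ m → hit x y m l ≡ 0
hit-miss {x} {m} y l x≢m with x ≡ᵇ m in x≡ᵇm
... | true  = contradiction (≡ᵇ⇒≡ x m (subst T (sym x≡ᵇm) tt)) x≢m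
... | false = refl

weight-hit : ∀ x y m l c₁ c₂ → (x ≡ m → y ≡ l → c₁ ≡ c₂) → c₁ * hit x y m l ≡ c₂ * hit x y m l
weight-hit x y m l c₁ c₂ eq with x ≡ᵇ m in x≡ᵇm | y ≡ᵇ l in y≡ᵇl
... | true  | true  = cong (_* 1) (eq (≡ᵇ⇒≡ x m (subst T (sym x≡ᵇm) tt)) (≡ᵇ⇒≡ y l (subst T (sym y≡ᵇl) tt)))
... | true  | false = trans (*-zeroʳ c₁) (sym (*-zeroʳ c₂))
... | false | _     = trans (*-zeroʳ c₁) (sym (*-zeroʳ c₂))

-- The right-hand side of the recurrence, F(m,l) standing for Z(k,n,m,l):
-- a new ball of an unused colour, one that creates a new pair, or one joining a
-- repeated colour.
newPair : ℕ → (ℕ → ℕ → ℕ) → ℕ → ℕ → ℕ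
newPair k F (suc (suc m)) (suc l) = (k ∸ m) * F m l
newPair k F _             _       = 0

newMatch : (ℕ → ℕ → ℕ) → ℕ → ℕ → ℕ
newMatch F zero    l = 0
newMatch F (suc m) l = l * F m l

recStep : ℕ → ℕ → (ℕ → ℕ → ℕ) → ℕ → ℕ → ℕ
recStep k n F m l = (n ∸ (l + (k ∸ m))) * F m l + newPair k F m l + newMatch F m l

newPair-cong : ∀ k {F G : ℕ → ℕ → ℕ} → (∀ m l → F m l ≡ G m l) → ∀ m l → newPair k F m l ≡ newPair k G m l
newPair-cong k F≡G (suc (suc m)) (suc l) = cong ((k ∸ m) *_) (F≡G m l)
newPair-cong k F≡G zero          l       = refl
newPair-cong k F≡G (suc zero)    l       = refl
newPair-cong k F≡G (suc (suc m)) zero    = refl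

recStep-cong : ∀ k n {F G : ℕ → ℕ → ℕ} → (∀ m l → F m l ≡ G m l) → ∀ m l → recStep k n F m l ≡ recStep k n G m l
recStep-cong k n F≡G m l =
  cong₂ _+_ (cong₂ _+_ (cong ((n ∸ (l + (k ∸ m))) *_) (F≡G m l)) (newPair-cong k F≡G m l)) (newMatch-cong m)
  where
  newMatch-cong : ∀ m → newMatch _ m l ≡ newMatch _ m l
  newMatch-cong zero    = refl
  newMatch-cong (suc m) = cong (l *_) (F≡G m l)

∑ₗ-recStep : {A : Set} (xs : List A) (k n : ℕ) (F : A → ℕ → ℕ → ℕ) (m l : ℕ) →
  ∑ₗ xs (λ x → recStep k n (F x) m l) ≡ recStep k n (λ m′ l′ → ∑ₗ xs (λ x → F x m′ l′)) m l
∑ₗ-recStep xs k n F m l = begin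
  ∑ₗ xs (λ x → c * F x m l + newPair k (F x) m l + newMatch (F x) m l)
    ≡⟨ ∑ₗ-+ xs _ _ ⟩
  ∑ₗ xs (λ x → c * F x m l + newPair k (F x) m l) + ∑ₗ xs (λ x → newMatch (F x) m l)
    ≡⟨ cong₂ _+_ (∑ₗ-+ xs _ _) (∑ₗ-newMatch m) ⟩
  ∑ₗ xs (λ x → c * F x m l) + ∑ₗ xs (λ x → newPair k (F x) m l) + newMatch ΣF m l
    ≡⟨ cong (_+ newMatch ΣF m l) (cong₂ _+_ (∑ₗ-*ˡ xs c (λ x → F x m l)) (∑ₗ-newPair m l)) ⟩
  c * ΣF m l + newPair k ΣF m l + newMatch ΣF m l ∎
  where
  c = n ∸ (l + (k ∸ m))
  ΣF : ℕ → ℕ → ℕ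
  ΣF m′ l′ = ∑ₗ xs (λ x → F x m′ l′)
  ∑ₗ-newPair : ∀ m l → ∑ₗ xs (λ x → newPair k (F x) m l) ≡ newPair k ΣF m l
  ∑ₗ-newPair (suc (suc m)) (suc l) = ∑ₗ-*ˡ xs (k ∸ m) (λ x → F x m l)
  ∑ₗ-newPair zero          l       = ∑ₗ-zero xs
  ∑ₗ-newPair (suc zero)    l       = ∑ₗ-zero xs
  ∑ₗ-newPair (suc (suc m)) zero    = ∑ₗ-zero xs
  ∑ₗ-newMatch : ∀ m → ∑ₗ xs (λ x → newMatch (F x) m l) ≡ newMatch ΣF m l
  ∑ₗ-newMatch zero    = ∑ₗ-zero xs
  ∑ₗ-newMatch (suc m) = ∑ₗ-*ˡ xs l (λ x → F x m l)

hit-after : ∀ q M R m l → hit (matchesAfter q M) (repeatsAfter q R) m l ≡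
  vacant q * hit M R m l + single q * hit (2 + M) (1 + R) m l + shared q * hit (1 + M) R m l
hit-after zero          M R m l = sym (trans (+-identityʳ _) (trans (+-identityʳ _) (+-identityʳ _)))
hit-after (suc zero)    M R m l = sym (trans (+-identityʳ _) (+-identityʳ _))
hit-after (suc (suc q)) M R m l = sym (+-identityʳ _)

vacant-term : ∀ k n M R m l V → V ≡ n ∸ (R + (k ∸ M)) → V * hit M R m l ≡ (n ∸ (l + (k ∸ m))) * hit M R m l
vacant-term k n M R m l V V≡ = weight-hit M R m l V _ (λ M≡m R≡l → trans V≡ (cong₂ (λ y x → n ∸ (y + (k ∸ x))) R≡l M≡m))

single-term : ∀ k M R m l S → S ≡ k ∸ M → S * hit (2 + M) (1 + R) m l ≡ newPair k (hit M R) m l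
single-term k M R (suc (suc m)) (suc l) S S≡ = weight-hit M R m l S (k ∸ m) (λ M≡m _ → trans S≡ (cong (k ∸_) M≡m))
single-term k M R zero          l       S S≡ = *-zeroʳ S
single-term k M R (suc zero)    l       S S≡ = *-zeroʳ S
single-term k M R (suc (suc m)) zero    S S≡ = trans (cong (λ b → S * 𝟙 b) (Bool.∧-zeroʳ (M ≡ᵇ m))) (*-zeroʳ S)

shared-term : ∀ M R m l D → D ≡ R → D * hit (1 + M) R m l ≡ newMatch (hit M R) m l
shared-term M R zero    l D D≡ = *-zeroʳ D
shared-term M R (suc m) l D D≡ = weight-hit M R m l D l (λ _ R≡l → trans D≡ R≡l)

module Recurrence (k n : ℕ) where
  open Prepend k n

  newBall-sum : (f : Fin k → Fin n) (m l : ℕ) →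
    ∑[ a < n ] hit (matchingBalls (a ◂ f)) (repeatedColours (a ◂ f)) m l ≡ recStep k n (hit (matchingBalls f) (repeatedColours f)) m l
  newBall-sum f m l = begin
    ∑[ a < n ] hit (matchingBalls (a ◂ f)) (repeatedColours (a ◂ f)) m l
      ≡⟨ sum-cong-≗ (λ a → cong₂ (λ x y → hit x y m l) (matchingBalls-◂ a f) (repeatedColours-◂ a f)) ⟩
    ∑[ a < n ] hit (matchesAfter (size a) M) (repeatsAfter (size a) R) m l
      ≡⟨ sum-cong-≗ (λ a → hit-after (size a) M R m l) ⟩
    ∑[ a < n ] (vacant (size a) * h₀ + single (size a) * h₁ + shared (size a) * h₂)
      ≡⟨ ∑-distrib-+ (λ a → vacant (size a) * h₀ + single (size a) * h₁) (λ a → shared (size a) * h₂) ⟩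
    ∑[ a < n ] (vacant (size a) * h₀ + single (size a) * h₁) + ∑[ a < n ] (shared (size a) * h₂)
      ≡⟨ cong (_+ ∑[ a < n ] (shared (size a) * h₂)) (∑-distrib-+ (λ a → vacant (size a) * h₀) (λ a → single (size a) * h₁)) ⟩
    ∑[ a < n ] (vacant (size a) * h₀) + ∑[ a < n ] (single (size a) * h₁) + ∑[ a < n ] (shared (size a) * h₂)
      ≡⟨ cong₂ _+_ (cong₂ _+_ (*-distribʳ-sum h₀ (λ a → vacant (size a))) (*-distribʳ-sum h₁ (λ a → single (size a))))
                   (*-distribʳ-sum h₂ (λ a → shared (size a))) ⟨
    #vacant * h₀ + #single * h₁ + ∑[ a < n ] shared (size a) * h₂
      ≡⟨ cong₂ _+_ (cong₂ _+_ (vacant-term k n M R m l #vacant #vacant≡) (single-term k M R m l #single #single≡))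
                   (shared-term M R m l _ (sym repeatedColours-as-sum)) ⟩
    recStep k n (hit M R) m l ∎
    where
    open Statistics f
    M = matchingBalls f
    R = repeatedColours f
    h₀ = hit M R m l
    h₁ = hit (2 + M) (1 + R) m l
    h₂ = hit (1 + M) R m l

Z-as-sum : ∀ k n m l → Z k n m l ≡ ∑ₗ (allFuns k n) (λ f → hit (matchingBalls f) (repeatedColours f) m l)
Z-as-sum k n m l = trans (countFuns-as-sum k n _) (∑ₗ-cong (allFuns k n) (λ f →
  cong₂ (λ u v → 𝟙 (u ∧ v)) (isYes≗does (matchingBalls f ≟ m)) (isYes≗does (repeatedColours f ≟ l))))

Z-rec : ∀ k n m l → Z (suc k) n m l ≡ recStep k n (Z k n) m l
Z-rec k n m l = begin
  Z (suc k) n m l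
    ≡⟨ Z-as-sum (suc k) n m l ⟩
  ∑ₗ (allFuns (suc k) n) (λ c → hit (matchingBalls c) (repeatedColours c) m l)
    ≡⟨ ∑ₗ-allFuns-suc _ ⟩
  ∑ₗ (allFuns k n) (λ f → ∑[ a < n ] hit (matchingBalls (a ◂ f)) (repeatedColours (a ◂ f)) m l)
    ≡⟨ ∑ₗ-cong (allFuns k n) (λ f → newBall-sum f m l) ⟩
  ∑ₗ (allFuns k n) (λ f → recStep k n (hit (matchingBalls f) (repeatedColours f)) m l)
    ≡⟨ ∑ₗ-recStep (allFuns k n) k n (λ f → hit (matchingBalls f) (repeatedColours f)) m l ⟩
  recStep k n (λ m′ l′ → ∑ₗ (allFuns k n) (λ f → hit (matchingBalls f) (repeatedColours f) m′ l′)) m l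
    ≡⟨ recStep-cong k n (λ m′ l′ → sym (Z-as-sum k n m′ l′)) m l ⟩
  recStep k n (Z k n) m l ∎
  where
  open Prepend k n
  open Recurrence k n

-- Boundary values of Z and the relation to s

-- There are at most k matching balls.
Z-vanishes : ∀ {k m} n l → k < m → Z k n m l ≡ 0
Z-vanishes {k} {m} n l k<m = begin
  Z k n m l                                                            ≡⟨ Z-as-sum k n m l ⟩
  ∑ₗ (allFuns k n) (λ f → hit (matchingBalls f) (repeatedColours f) m l) ≡⟨ ∑ₗ-cong (allFuns k n) miss ⟩
  ∑ₗ (allFuns k n) (λ _ → 0)                                           ≡⟨ ∑ₗ-zero (allFuns k n) ⟩
  0                                                                    ∎
  where
  miss : ∀ f → hit (matchingBalls f) (repeatedColours f) m l ≡ 0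
  miss f = hit-miss (repeatedColours f) l
    (λ M≡m → <⇒≱ k<m (subst (_≤ k) M≡m (Statistics.matchingBalls≤k f)))

allFinB-as-count : (n : ℕ) (b : Fin n → Bool) → allFinB n b ≡ (∑[ x < n ] 𝟙 (b x) ≡ᵇ n)
allFinB-as-count zero    b = refl
allFinB-as-count (suc n) b with b zero
... | true  = allFinB-as-count n (λ x → b (suc x))
... | false = sym (≤⇒≢ᵇsuc (∑-𝟙≤ n (λ x → b (suc x))))
  where
  ∑-𝟙≤ : (n : ℕ) (b : Fin n → Bool) → ∑[ x < n ] 𝟙 (b x) ≤ n
  ∑-𝟙≤ zero    b = z≤n
  ∑-𝟙≤ (suc n) b with b zero
  ... | true  = s≤s (∑-𝟙≤ n (λ x → b (suc x)))
  ... | false = m≤n⇒m≤1+n (∑-𝟙≤ n (λ x → b (suc x)))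
  ≤⇒≢ᵇsuc : ∀ {s n} → s ≤ n → (s ≡ᵇ suc n) ≡ false
  ≤⇒≢ᵇsuc z≤n       = refl
  ≤⇒≢ᵇsuc (s≤s s≤n) = ≤⇒≢ᵇsuc s≤n

-- A colouring of m balls with l colours is doubly surjective iff all l colours are
-- repeated, and then all m balls match: s(m,l) = Z(m,l,m,l).
s-as-Z : ∀ m l → s m l ≡ Z m l m l
s-as-Z m l = begin
  s m l                                              ≡⟨ countFuns-as-sum m l _ ⟩
  ∑ₗ (allFuns m l) (λ f → 𝟙 (allFinB l (repeated f))) ≡⟨ ∑ₗ-cong (allFuns m l) (λ f → cong 𝟙 (doublySurjective⇔hit f)) ⟩
  ∑ₗ (allFuns m l) (λ f → hit (matchingBalls f) (repeatedColours f) m l) ≡⟨ Z-as-sum m l m l ⟨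
  Z m l m l                                          ∎
  where
  doublySurjective⇔hit : (f : Fin m → Fin l) →
    allFinB l (repeated f) ≡ (matchingBalls f ≡ᵇ m) ∧ (repeatedColours f ≡ᵇ l)
  doublySurjective⇔hit f
    rewrite allFinB-as-count l (repeated f) | sym (countFin-as-sum l (repeated f))
    with repeatedColours f ≡ᵇ l in R≡ᵇl
  ... | false = sym (Bool.∧-zeroʳ _)
  ... | true  = sym (trans (Bool.∧-identityʳ _) (Equivalence.to Bool.T-≡ (≡⇒≡ᵇ _ m M≡m)))
    where
    M≡m : matchingBalls f ≡ m
    M≡m = Statistics.all-repeated⇒all-match f (≡ᵇ⇒≡ _ l (subst T (sym R≡ᵇl) tt))

Z-empty : ∀ n l → Z 0 n 0 l ≡ s 0 l
Z-empty n l = begin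
  Z 0 n 0 l                 ≡⟨ Z-as-sum 0 n 0 l ⟩
  hit 0 R 0 l + 0           ≡⟨ cong (λ r → hit 0 r 0 l + 0) R≡0 ⟩
  hit 0 0 0 l + 0           ≡⟨ s-empty l ⟩
  s 0 l                     ∎
  where
  R = repeatedColours {0} {n} (λ ())
  R≡0 : R ≡ 0
  R≡0 = trans (countFin-as-sum n _) (sum-replicate-zero n)
  s-empty : ∀ l → hit 0 0 0 l + 0 ≡ s 0 l
  s-empty zero    = refl
  s-empty (suc l) = refl

-- Binomial coefficients and falling factorials

-- The linear form of the absorption identity, proved by Pascal's rule.
C-linear : ∀ n k → (n C k) * n ≡ (n C suc k) * suc k + (n C k) * k
C-linear zero    zero    = refl
C-linear zero    (suc k) rewrite k>n⇒nCk≡0 {0} {suc k} z<s | k>n⇒nCk≡0 {0} {suc (suc k)} z<s = refl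
C-linear (suc n) zero    = begin
  (suc n C 0) * suc n               ≡⟨ *-identityˡ (suc n) ⟩
  suc n                             ≡⟨ nC1≡n (suc n) ⟨
  suc n C 1                         ≡⟨ trans (cong₂ _+_ (*-identityʳ _) (*-zeroʳ (suc n C 0))) (+-identityʳ _) ⟨
  (suc n C 1) * 1 + (suc n C 0) * 0 ∎
C-linear (suc n) (suc k) = begin
  (suc n C suc k) * suc n
    ≡⟨ cong (_* suc n) (nCk+nC[k+1]≡[n+1]C[k+1] n k) ⟨
  (a + b) * suc n
    ≡⟨ solve 3 (λ a b n → (a :+ b) :* (con 1 :+ n) := a :* n :+ a :+ (b :* n :+ b)) refl a b n ⟩
  a * n + a + (b * n + b)
    ≡⟨ cong₂ (λ u v → u + a + (v + b)) (C-linear n k) (C-linear n (suc k)) ⟩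
  b * suc k + a * k + a + (c * suc (suc k) + b * suc k + b)
    ≡⟨ solve 4 (λ a b c k → b :* (con 1 :+ k) :+ a :* k :+ a :+ (c :* (con 2 :+ k) :+ b :* (con 1 :+ k) :+ b)
                         := (b :+ c) :* (con 2 :+ k) :+ (a :+ b) :* (con 1 :+ k)) refl a b c k ⟩
  (b + c) * suc (suc k) + (a + b) * suc k
    ≡⟨ cong₂ (λ u v → u * suc (suc k) + v * suc k) (nCk+nC[k+1]≡[n+1]C[k+1] n (suc k)) (nCk+nC[k+1]≡[n+1]C[k+1] n k) ⟩
  (suc n C suc (suc k)) * suc (suc k) + (suc n C suc k) * suc k ∎
  where
  a = n C k
  b = n C suc k
  c = n C suc (suc k)

C-absorb : ∀ n k → (n C k) * (n ∸ k) ≡ (n C suc k) * suc k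
C-absorb n k with k ≤? n
... | yes k≤n = +-cancelˡ-≡ ((n C k) * k) _ _ (begin
  (n C k) * k + (n C k) * (n ∸ k)   ≡⟨ *-distribˡ-+ (n C k) k (n ∸ k) ⟨
  (n C k) * (k + (n ∸ k))           ≡⟨ cong ((n C k) *_) (m+[n∸m]≡n k≤n) ⟩
  (n C k) * n                       ≡⟨ C-linear n k ⟩
  (n C suc k) * suc k + (n C k) * k ≡⟨ +-comm _ ((n C k) * k) ⟩
  (n C k) * k + (n C suc k) * suc k ∎)
... | no k≰n = begin
  (n C k) * (n ∸ k)   ≡⟨ cong (_* (n ∸ k)) (k>n⇒nCk≡0 (≰⇒> k≰n)) ⟩
  0                   ≡⟨ cong (_* suc k) (k>n⇒nCk≡0 (m<n⇒m<1+n (≰⇒> k≰n))) ⟨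
  (n C suc k) * suc k ∎

P′-head : ∀ a b → a P′ suc b ≡ a * (pred a P′ b)
P′-head zero    b       = cong (_* (0 P′ b)) (0∸n≡0 b)
P′-head (suc a) zero    = refl
P′-head (suc a) (suc b) = begin
  (a ∸ b) * (suc a P′ suc b)   ≡⟨ cong ((a ∸ b) *_) (P′-head (suc a) b) ⟩
  (a ∸ b) * (suc a * (a P′ b)) ≡⟨ solve 3 (λ x y z → x :* (y :* z) := y :* (x :* z)) refl (a ∸ b) (suc a) (a P′ b) ⟩
  suc a * ((a ∸ b) * (a P′ b)) ∎

P′-fact : ∀ a j → j ≤ a → (a P′ j) * (a ∸ j) ! ≡ a !
P′-fact a zero    _   = *-identityˡ (a !)
P′-fact a (suc j) j<a = begin
  (a ∸ j) * (a P′ j) * (a ∸ suc j) !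
    ≡⟨ solve 3 (λ x p f → x :* p :* f := p :* (x :* f)) refl (a ∸ j) (a P′ j) ((a ∸ suc j) !) ⟩
  (a P′ j) * ((a ∸ j) * (a ∸ suc j) !)
    ≡⟨ cong ((a P′ j) *_) ([n-k]*[n-k-1]!≡[n-k]! j<a) ⟩
  (a P′ j) * (a ∸ j) !
    ≡⟨ P′-fact a j (<⇒≤ j<a) ⟩
  a ! ∎

-- The closed form

closedForm : ℕ → ℕ → ℕ → ℕ → ℕ
closedForm k n m l = (n C l) * (k C m) * ((n ∸ l) P′ (k ∸ m)) * s m l

-- l m s(m-1,l-1): doubly-surjective maps on m+1 points whose last point has exactly one partner.
sPaired : ℕ → ℕ → ℕ
sPaired zero    l       = 0
sPaired (suc m) zero    = 0
sPaired (suc m) (suc l) = suc l * suc m * s m l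

closedForm-vanishes : ∀ {k m} n l → k < m → closedForm k n m l ≡ 0
closedForm-vanishes {k} {m} n l k<m = begin
  (n C l) * (k C m) * ((n ∸ l) P′ (k ∸ m)) * s m l
    ≡⟨ cong (λ t → (n C l) * t * ((n ∸ l) P′ (k ∸ m)) * s m l) (k>n⇒nCk≡0 k<m) ⟩
  (n C l) * 0 * ((n ∸ l) P′ (k ∸ m)) * s m l
    ≡⟨ solve 3 (λ a p x → a :* con 0 :* p :* x := con 0) refl (n C l) ((n ∸ l) P′ (k ∸ m)) (s m l) ⟩
  0 ∎

newPair-closedForm : ∀ {m k} n l → m ≤ k →
  newPair k (closedForm k n) (suc m) l ≡ (n C l) * (k C m) * ((n ∸ l) P′ (k ∸ m)) * sPaired m l
newPair-closedForm {zero}  {k} n l    _ = sym (*-zeroʳ ((n C l) * (k C 0) * ((n ∸ l) P′ (k ∸ 0))))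
newPair-closedForm {suc m} {k} n zero _ = sym (*-zeroʳ ((n C 0) * (k C suc m) * ((n ∸ 0) P′ (k ∸ suc m))))
newPair-closedForm {suc m} {k} n (suc l) m<k = begin
  (k ∸ m) * ((n C l) * (k C m) * ((n ∸ l) P′ (k ∸ m)) * s m l)
    ≡⟨ cong (λ t → (k ∸ m) * ((n C l) * (k C m) * t * s m l)) P′-split ⟩
  (k ∸ m) * ((n C l) * (k C m) * ((n ∸ l) * Q) * s m l)
    ≡⟨ solve 6 (λ x a b y q t → x :* (a :* b :* (y :* q) :* t) := (a :* y) :* (b :* x) :* q :* t) refl
         (k ∸ m) (n C l) (k C m) (n ∸ l) Q (s m l) ⟩
  ((n C l) * (n ∸ l)) * ((k C m) * (k ∸ m)) * Q * s m l
    ≡⟨ cong₂ (λ u v → u * v * Q * s m l) (C-absorb n l) (C-absorb k m) ⟩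
  ((n C suc l) * suc l) * ((k C suc m) * suc m) * Q * s m l
    ≡⟨ solve 6 (λ a y b x q t → (a :* y) :* (b :* x) :* q :* t := a :* b :* q :* (y :* x :* t)) refl
         (n C suc l) (suc l) (k C suc m) (suc m) Q (s m l) ⟩
  (n C suc l) * (k C suc m) * Q * (suc l * suc m * s m l) ∎
  where
  j = k ∸ suc m
  Q = (n ∸ suc l) P′ j
  P′-split : (n ∸ l) P′ (k ∸ m) ≡ (n ∸ l) * Q
  P′-split = begin
    (n ∸ l) P′ (k ∸ m)            ≡⟨ cong ((n ∸ l) P′_) (+-∸-assoc 1 m<k) ⟩
    (n ∸ l) P′ suc j              ≡⟨ P′-head (n ∸ l) j ⟩
    (n ∸ l) * (pred (n ∸ l) P′ j) ≡⟨ cong (λ t → (n ∸ l) * (t P′ j)) (pred[m∸n]≡m∸[1+n] n l) ⟩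
    (n ∸ l) * Q                   ∎

vacant-closedForm : ∀ {m k} n l → m ≤ k →
  (n ∸ (l + (k ∸ suc m))) * closedForm k n (suc m) l ≡ (n C l) * (k C suc m) * ((n ∸ l) P′ (k ∸ m)) * s (suc m) l
vacant-closedForm {m} {k} n l m≤k with m≤n⇒m<n∨m≡n m≤k
... | inj₁ m<k = begin
  (n ∸ (l + j)) * ((n C l) * (k C suc m) * ((n ∸ l) P′ j) * s (suc m) l)
    ≡⟨ cong (_* ((n C l) * (k C suc m) * ((n ∸ l) P′ j) * s (suc m) l)) (∸-+-assoc n l j) ⟨
  (n ∸ l ∸ j) * ((n C l) * (k C suc m) * ((n ∸ l) P′ j) * s (suc m) l)
    ≡⟨ solve 5 (λ x a b p t → x :* (a :* b :* p :* t) := a :* b :* (x :* p) :* t) refl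
         (n ∸ l ∸ j) (n C l) (k C suc m) ((n ∸ l) P′ j) (s (suc m) l) ⟩
  (n C l) * (k C suc m) * ((n ∸ l) P′ suc j) * s (suc m) l
    ≡⟨ cong (λ t → (n C l) * (k C suc m) * ((n ∸ l) P′ t) * s (suc m) l) (+-∸-assoc 1 m<k) ⟨
  (n C l) * (k C suc m) * ((n ∸ l) P′ (k ∸ m)) * s (suc m) l ∎
  where j = k ∸ suc m
... | inj₂ refl rewrite k>n⇒nCk≡0 (n<1+n m) =
  solve 5 (λ x a p q t → x :* (a :* con 0 :* p :* t) := a :* con 0 :* q :* t) refl
    (n ∸ (l + (m ∸ suc m))) (n C l) ((n ∸ l) P′ (m ∸ suc m)) ((n ∸ l) P′ (m ∸ m)) (s (suc m) l)

-- The closed form satisfies the recurrence of Z: for m = 0 directly, and for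
-- m ≥ 1 by Pascal's rule once s satisfies its own recurrence at m.
closedForm-rec-zero : ∀ k n l → closedForm (suc k) n 0 l ≡ recStep k n (closedForm k n) 0 l
closedForm-rec-zero k n l = begin
  (n C l) * 1 * ((n ∸ l ∸ k) * ((n ∸ l) P′ k)) * s 0 l
    ≡⟨ solve 4 (λ x a p t → a :* con 1 :* (x :* p) :* t := x :* (a :* con 1 :* p :* t) :+ con 0 :+ con 0) refl
         (n ∸ l ∸ k) (n C l) ((n ∸ l) P′ k) (s 0 l) ⟩
  (n ∸ l ∸ k) * closedForm k n 0 l + 0 + 0
    ≡⟨ cong (λ x → x * closedForm k n 0 l + 0 + 0) (∸-+-assoc n l k) ⟩
  (n ∸ (l + k)) * closedForm k n 0 l + 0 + 0 ∎

closedForm-rec-suc : ∀ {m k} n l → m ≤ k → s (suc m) l ≡ l * s m l + sPaired m l →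
  closedForm (suc k) n (suc m) l ≡ recStep k n (closedForm k n) (suc m) l
closedForm-rec-suc {m} {k} n l m≤k s-rec = begin
  A * (suc k C suc m) * P * s (suc m) l
    ≡⟨ cong (λ t → A * t * P * s (suc m) l) (nCk+nC[k+1]≡[n+1]C[k+1] k m) ⟨
  A * ((k C m) + (k C suc m)) * P * s (suc m) l
    ≡⟨ solve 5 (λ a b b′ p t → a :* (b :+ b′) :* p :* t := a :* b′ :* p :* t :+ a :* b :* p :* t) refl
         A (k C m) (k C suc m) P (s (suc m) l) ⟩
  A * (k C suc m) * P * s (suc m) l + A * (k C m) * P * s (suc m) l
    ≡⟨ cong (λ t → A * (k C suc m) * P * s (suc m) l + A * (k C m) * P * t) s-rec ⟩
  A * (k C suc m) * P * s (suc m) l + A * (k C m) * P * (l * s m l + sPaired m l)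
    ≡⟨ solve 7 (λ u a b p l t t′ → u :+ a :* b :* p :* (l :* t :+ t′) := u :+ a :* b :* p :* t′ :+ l :* (a :* b :* p :* t)) refl
         (A * (k C suc m) * P * s (suc m) l) A (k C m) P l (s m l) (sPaired m l) ⟩
  A * (k C suc m) * P * s (suc m) l + A * (k C m) * P * sPaired m l + l * closedForm k n m l
    ≡⟨ cong₂ (λ u v → u + v + l * closedForm k n m l) (vacant-closedForm n l m≤k) (newPair-closedForm n l m≤k) ⟨
  recStep k n (closedForm k n) (suc m) l ∎
  where
  A = n C l
  P = (n ∸ l) P′ (k ∸ m)

-- The closed form of Z, by strong induction on the number of balls

ClosedFormAt : ℕ → Set
ClosedFormAt k = ∀ n m l → Z k n m l ≡ closedForm k n m l

-- The recurrence of s at m, obtained from that of Z at k = m, n = l; the new-pair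
-- term needs the closed form for sequences of length m.
s-rec : ∀ m → ClosedFormAt m → ∀ l → s (suc m) l ≡ l * s m l + sPaired m l
s-rec m closed l = begin
  s (suc m) l
    ≡⟨ s-as-Z (suc m) l ⟩
  Z (suc m) l (suc m) l
    ≡⟨ Z-rec m l (suc m) l ⟩
  c * Z m l (suc m) l + newPair m (Z m l) (suc m) l + l * Z m l m l
    ≡⟨ cong₂ _+_ (cong₂ _+_ (cong (c *_) (Z-vanishes l l (n<1+n m)))
                            (trans (newPair-cong m (closed l) (suc m) l) (newPair-closedForm {m} {m} l l ≤-refl)))
                 (cong (l *_) (sym (s-as-Z m l))) ⟩
  c * 0 + (l C l) * (m C m) * ((l ∸ l) P′ (m ∸ m)) * sPaired m l + l * s m l
    ≡⟨ cong (λ t → c * 0 + t * sPaired m l + l * s m l) unit ⟩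
  c * 0 + 1 * sPaired m l + l * s m l
    ≡⟨ solve 4 (λ c p l t → c :* con 0 :+ con 1 :* p :+ l :* t := l :* t :+ p) refl c (sPaired m l) l (s m l) ⟩
  l * s m l + sPaired m l ∎
  where
  c = l ∸ (l + (m ∸ suc m))
  unit : (l C l) * (m C m) * ((l ∸ l) P′ (m ∸ m)) ≡ 1
  unit rewrite nCn≡1 l | nCn≡1 m | n∸n≡0 l | n∸n≡0 m = refl

-- Below the diagonal m ≤ k, Z(k,·,m,·) follows from the closed form at length k - 1
-- through the recurrence; s needs the closed form at length m - 1.
closedForm-below : ∀ k → (∀ {k′} → k′ < k → ClosedFormAt k′) → ∀ n m l → m ≤ k → Z k n m l ≡ closedForm k n m l
closedForm-below zero    _      n zero    zero    z≤n = Z-empty n 0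
closedForm-below zero    _      n zero    (suc l) z≤n = trans (Z-empty n (suc l)) (sym (*-zeroʳ ((n C suc l) * 1 * 1)))
closedForm-below (suc k) closed n zero    l _         = begin
  Z (suc k) n 0 l                         ≡⟨ Z-rec k n 0 l ⟩
  recStep k n (Z k n) 0 l                 ≡⟨ recStep-cong k n (closed ≤-refl n) 0 l ⟩
  recStep k n (closedForm k n) 0 l        ≡⟨ closedForm-rec-zero k n l ⟨
  closedForm (suc k) n 0 l                ∎
closedForm-below (suc k) closed n (suc m) l (s≤s m≤k) = begin
  Z (suc k) n (suc m) l                   ≡⟨ Z-rec k n (suc m) l ⟩
  recStep k n (Z k n) (suc m) l           ≡⟨ recStep-cong k n (closed ≤-refl n) (suc m) l ⟩
  recStep k n (closedForm k n) (suc m) l  ≡⟨ closedForm-rec-suc n l m≤k (s-rec m (closed (s≤s m≤k)) l) ⟨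
  closedForm (suc k) n (suc m) l          ∎

-- Strong induction on k; above the diagonal m > k both sides vanish.
Z≡closedForm : ∀ k → ClosedFormAt k
Z≡closedForm = <-rec ClosedFormAt step
  where
  step : ∀ k → (∀ {k′} → k′ < k → ClosedFormAt k′) → ClosedFormAt k
  step k closed n m l with m ≤? k
  ... | yes m≤k = closedForm-below k closed n m l m≤k
  ... | no  m≰k = trans (Z-vanishes n l (≰⇒> m≰k)) (sym (closedForm-vanishes n l (≰⇒> m≰k)))

closedForm-cleared : ∀ k n m l → l + k ≤ n + m →
  closedForm k n m l * (n + m ∸ (l + k)) ! ≡ (n C l) * (k C m) * (n ∸ l) ! * s m l
closedForm-cleared k n m l l+k≤n+m with m ≤? k
... | no m≰k rewrite k>n⇒nCk≡0 (≰⇒> m≰k) =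
  solve 5 (λ a p t f g → a :* con 0 :* p :* t :* f := a :* con 0 :* g :* t) refl
    (n C l) ((n ∸ l) P′ (k ∸ m)) (s m l) ((n + m ∸ (l + k)) !) ((n ∸ l) !)
... | yes m≤k = begin
  (n C l) * (k C m) * ((n ∸ l) P′ j) * s m l * (n + m ∸ (l + k)) !
    ≡⟨ cong (λ t → (n C l) * (k C m) * ((n ∸ l) P′ j) * s m l * t !) n+m∸[l+k]≡n∸l∸j ⟩
  (n C l) * (k C m) * ((n ∸ l) P′ j) * s m l * (n ∸ l ∸ j) !
    ≡⟨ solve 5 (λ a b p t f → a :* b :* p :* t :* f := a :* b :* (p :* f) :* t) refl
         (n C l) (k C m) ((n ∸ l) P′ j) (s m l) ((n ∸ l ∸ j) !) ⟩
  (n C l) * (k C m) * (((n ∸ l) P′ j) * (n ∸ l ∸ j) !) * s m l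
    ≡⟨ cong (λ t → (n C l) * (k C m) * t * s m l) (P′-fact (n ∸ l) j j≤n∸l) ⟩
  (n C l) * (k C m) * (n ∸ l) ! * s m l ∎
  where
  j = k ∸ m
  l+k≡m+[l+j] : l + k ≡ m + (l + j)
  l+k≡m+[l+j] = begin
    l + k           ≡⟨ cong (l +_) (m+[n∸m]≡n m≤k) ⟨
    l + (m + j)     ≡⟨ solve 3 (λ l m j → l :+ (m :+ j) := m :+ (l :+ j)) refl l m j ⟩
    m + (l + j)     ∎
  n+m∸[l+k]≡n∸l∸j : n + m ∸ (l + k) ≡ n ∸ l ∸ j
  n+m∸[l+k]≡n∸l∸j = begin
    n + m ∸ (l + k)          ≡⟨ cong₂ _∸_ (+-comm n m) l+k≡m+[l+j] ⟩
    m + n ∸ (m + (l + j))    ≡⟨ [m+n]∸[m+o]≡n∸o m n (l + j) ⟩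
    n ∸ (l + j)              ≡⟨ ∸-+-assoc n l j ⟨
    n ∸ l ∸ j                ∎
  l+j≤n : l + j ≤ n
  l+j≤n = +-cancelˡ-≤ m (l + j) n (subst₂ _≤_ l+k≡m+[l+j] (+-comm n m) l+k≤n+m)
  j≤n∸l : j ≤ n ∸ l
  j≤n∸l = m+n≤o⇒m≤o∸n j (subst (_≤ n) (+-comm l j) l+j≤n)

-- Only the hypothesis l + k ≤ n + m, i.e. l ≤ n - k + m, is needed: it makes the
-- truncated subtraction (n + m) ∸ (l + k) equal to n - l - (k - m).
mainTheorem1 : (k n m l : ℕ) → k < n + m → 2 * l ≤ m → l + k ≤ n + m →
    Z k n m l * ((n + m) ∸ (l + k)) ! ≡ (n C l) * (k C m) * (n ∸ l) ! * s m l
mainTheorem1 k n m l _ _ l+k≤n+m = begin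
  Z k n m l * ((n + m) ∸ (l + k)) !           ≡⟨ cong (_* ((n + m) ∸ (l + k)) !) (Z≡closedForm k n m l) ⟩
  closedForm k n m l * ((n + m) ∸ (l + k)) !  ≡⟨ closedForm-cleared k n m l l+k≤n+m ⟩
  (n C l) * (k C m) * (n ∸ l) ! * s m l       ∎
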